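{- Let $L$ be a Latin square of order $n$ that is isotopic to its transpose. For $X\in\{123,132,213,231,312,321\}$ let $\mathcal{F}_X$ denote the ordered $1$-factorisation of $K_{n,n}$ with $\mathcal{L}(\mathcal{F}_X)$ equal to the $(X)$-conjugate of $L$. Then $\mathcal{F}_{123},\mathcal{F}_{132},\mathcal{F}_{213}$ and $\mathcal{F}_{231}$ are all isomorphic. Hence, if $L$ is row-Hamiltonian then $\nu(L)\in\{4,6\}$, and if the $(321)$-conjugate of $L$ is row-Hamiltonian then $\nu(L)\in\{2,6\}$.
   Context: A Latin square of order $n$ is an $n\times n$ matrix on $n$ symbols, each occurring once in each row and column; rows and columns are indexed by the symbol set, here $\{1,\dots,n\}$. We view $L$ as the set of $n^2$ entries $(\text{row},\text{column},\text{symbol})$. For a one-line permutation $X=x_1x_2x_3$ of $\{1,2,3\}$, the $(X)$-conjugate of $L$ is the Latin square $\{(a_{x_1},a_{x_2},a_{x_3}) : (a_1,a_2,a_3)\in L\}$ (so the $(132)$-conjugate, the row-inverse, has entries (row, symbol, column), and the $(213)$-conjugate is the transpose). Latin squares are isotopic if one is obtained from the other by permuting rows, columns and symbols. A $2\times k$ subrectangle of a Latin square is a $2\times k$ submatrix that is itself a Latin rectangle (each of its $k$ symbols occurs once in each row); a row cycle of length $k$ is a $2\times k$ subrectangle containing no smaller such subrectangle. $L$ is row-Hamiltonian if all its row cycles have length $n$. $\nu(L)$ is the number of the six conjugates of $L$ that are row-Hamiltonian. Label one side of $K_{n,n}$ by $c_1,\dots,c_n$ (columns) and the other by $s_1,\dots,s_n$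 (symbols). For a Latin square $M$, row $i$ gives the $1$-factor $f_i=\{c_js_k : M_{i,j}=k\}$, and $[f_1,\dots,f_n]$ is an ordered $1$-factorisation of $K_{n,n}$; this is a bijection, and $\mathcal{L}(\mathcal{F})$ denotes the Latin square corresponding to the ordered $1$-factorisation $\mathcal{F}$. Two (ordered) $1$-factorisations are isomorphic if some permutation of the vertices of $K_{n,n}$ maps the set of $1$-factors of one onto the set of $1$-factors of the other. -}

module Defs where

open import Data.Nat using (ℕ; zero; suc)
open import Data.Fin using (Fin)
open import Data.Fin.Subset using (Subset; _∈_; _⊂_; ∣_∣; Nonempty)
open import Data.Bool using (Bool; true)
open import Data.Empty using (⊥)
open import Data.Product using (Σ; ∃; ∃!; _×_; _,_)
open import Data.Sum using (_⊎_; inj₁; inj₂)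
open import Data.List using (List; []; _∷_)
open import Relation.Binary.PropositionalEquality using (_≡_)
open import Relation.Nullary using (¬_)
open import Function.Bundles using (_↔_; _⇔_; Inverse)

-- Latin squares, viewed as sets of entries (row, column, symbol).
-- A candidate square of order n is the characteristic function of a set
-- of triples in Fin n × Fin n × Fin n.

Triples : ℕ → Set
Triples n = Fin n → Fin n → Fin n → Bool

Ent : ∀ {n} → Triples n → Fin n → Fin n → Fin n → Set
Ent T a b c = T a b c ≡ true

IsLatin : ∀ {n} → Triples n → Set
IsLatin {n} T =
  (∀ (r c : Fin n) → ∃! _≡_ (λ s → Ent T r c s)) ×
  (∀ (r s : Fin n) → ∃! _≡_ (λ c → Ent T r c s)) ×
  (∀ (c s : Fin n) → ∃! _≡_ (λ r → Ent T r c s))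

-- Conjugates.  For X = x1x2x3, the (X)-conjugate is
--   { (a_{x1}, a_{x2}, a_{x3}) : (a1,a2,a3) ∈ L }.
-- So (b1,b2,b3) is in it iff (a1,a2,a3) ∈ L where a_{xi} = bi.

data Perm3 : Set where
  p123 p132 p213 p231 p312 p321 : Perm3

allPerm3 : List Perm3
allPerm3 = p123 ∷ p132 ∷ p213 ∷ p231 ∷ p312 ∷ p321 ∷ []

conj : ∀ {n} → Perm3 → Triples n → Triples n
conj p123 T b1 b2 b3 = T b1 b2 b3
conj p132 T b1 b2 b3 = T b1 b3 b2
conj p213 T b1 b2 b3 = T b2 b1 b3
conj p231 T b1 b2 b3 = T b3 b1 b2
conj p312 T b1 b2 b3 = T b2 b3 b1
conj p321 T b1 b2 b3 = T b3 b2 b1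

transpose : ∀ {n} → Triples n → Triples n
transpose = conj p213

Isotopic : ∀ {n} → Triples n → Triples n → Set
Isotopic {n} T T' =
  Σ (Fin n ↔ Fin n) λ α → Σ (Fin n ↔ Fin n) λ β → Σ (Fin n ↔ Fin n) λ γ →
    ∀ (a b c : Fin n) →
      T a b c ≡ T' (Inverse.to α a) (Inverse.to β b) (Inverse.to γ c)

-- Row cycles.  A 2×k subrectangle in distinct rows r, r' on the column
-- set C (with k = ∣ C ∣ ≥ 1): the symbols in row r over C are exactly
-- the symbols in row r' over C.

Subrect : ∀ {n} → Triples n → Fin n → Fin n → Subset n → Set
Subrect {n} T r r' C =
  ¬ (r ≡ r') × Nonempty C ×
  (∀ (s : Fin n) →
     (∃ λ c → c ∈ C × Ent T r c s) ⇔ (∃ λ c → c ∈ C × Ent T r' c s))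

RowCycle : ∀ {n} → Triples n → Fin n → Fin n → Subset n → Set
RowCycle T r r' C =
  Subrect T r r' C × (∀ C' → C' ⊂ C → ¬ Subrect T r r' C')

RowHam : ∀ {n} → Triples n → Set
RowHam {n} T = ∀ r r' C → RowCycle T r r' C → ∣ C ∣ ≡ n

data Count {A : Set} (P : A → Set) : List A → ℕ → Set where
  nil  : Count P [] zero
  here : ∀ {x xs k} → P x → Count P xs k → Count P (x ∷ xs) (suc k)
  skip : ∀ {x xs k} → ¬ P x → Count P xs k → Count P (x ∷ xs) k

NuIs : ∀ {n} → Triples n → ℕ → Set
NuIs T k = Count (λ X → RowHam (conj X T)) allPerm3 k

-- 1-factorisations of K_{n,n}.  Vertices: inj₁ j = c_j, inj₂ k = s_k.
-- An edge set is a (symmetric) binary relation on vertices.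

Vertex : ℕ → Set
Vertex n = Fin n ⊎ Fin n

EdgeSet : ℕ → Set₁
EdgeSet n = Vertex n → Vertex n → Set

OrdFact : ℕ → Set₁
OrdFact n = Fin n → EdgeSet n

rowFactor : ∀ {n} → Triples n → Fin n → EdgeSet n
rowFactor T i (inj₁ j) (inj₂ k) = Ent T i j k
rowFactor T i (inj₂ k) (inj₁ j) = Ent T i j k
rowFactor T i (inj₁ _) (inj₁ _) = ⊥
rowFactor T i (inj₂ _) (inj₂ _) = ⊥

𝓕 : ∀ {n} → Triples n → OrdFact n
𝓕 T = rowFactor T

MapsOnto : ∀ {n} → (Vertex n ↔ Vertex n) → EdgeSet n → EdgeSet n → Set
MapsOnto {n} π f g =
  ∀ (u v : Vertex n) → f u v ⇔ g (Inverse.to π u) (Inverse.to π v)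

Isomorphic : ∀ {n} → OrdFact n → OrdFact n → Set
Isomorphic {n} F G =
  Σ (Vertex n ↔ Vertex n) λ π →
    (∀ i → ∃ λ i' → MapsOnto π (F i) (G i')) ×
    (∀ i' → ∃ λ i → MapsOnto π (F i) (G i'))

𝓕[_] : ∀ {n} → Perm3 → Triples n → OrdFact n
𝓕[ X ] T = 𝓕 (conj X T)

module Submission where

-- Swapping the two sides of K_{n,n} carries 𝓕 M onto 𝓕 of the row-inverse M^(132), and an
-- isotopy (α, β, γ) from M to M′ gives the vertex permutation β ⊎ γ, which carries the 1-factor
-- of row i onto that of row α i.  As L is isotopic to its transpose L^(213), whose row-inverse
-- is L^(231), the factorisations 𝓕_123, 𝓕_132, 𝓕_213 and 𝓕_231 are all isomorphic.
--
-- Row-Hamiltonicity is invariant under the same two operations: the row cycles of M in rows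
-- r, r′ on the columns C are, up to the same bijection, those of M^(132) in rows r, r′ on the
-- symbols that row r of M has in the columns C.  Hence the six conjugates fall into the classes
-- {123, 132, 213, 231} and {312, 321} (as 321 is the row-inverse of 312), each of which is
-- row-Hamiltonian as a whole or not at all.

open import Defs
open import Level using (0ℓ)
open import Data.Bool using (true; if_then_else_) renaming (_≟_ to _≟ᵇ_)
open import Data.Nat using (ℕ; _+_) renaming (_≟_ to _≟ℕ_)
open import Data.Fin using (Fin) renaming (_≟_ to _≟ᶠ_)
open import Data.Fin.Properties using (all?; any?)
open import Data.Fin.Subset using (Subset; _∈_; _⊂_; ∣_∣; Nonempty; ⊤)
open import Data.Fin.Subset.Properties
  using (∣p∣≡n⇒p≡⊤; ∣⊤∣≡n; ∈⊤; ⊆⊤; ⊆-antisym; _∈?_; nonempty?; _⊂?_; anySubset?)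
open import Data.Vec using (tabulate; lookup)
open import Data.Vec.Properties
  using (lookup∘tabulate; tabulate∘lookup; tabulate-cong; []=⇒lookup; lookup⇒[]=)
open import Data.Product using (Σ; ∃; ∃₂; _×_; _,_; proj₁; proj₂; uncurry) renaming (map₂ to mapΣ₂)
open import Data.Product.Function.NonDependent.Propositional using (_×-⇔_)
open import Data.List using ([]; _∷_)
open import Data.Sum using (_⊎_; inj₁; inj₂)
open import Data.Sum.Properties using (swap-↔)
open import Data.Sum.Algebra using (⊎-cong)
open import Function using (_∘_)
open import Function.Bundles using (_↔_; _⇔_; Inverse; Equivalence; Injection; mk⇔; mk↔ₛ′)
open import Function.Properties.Inverse using (↔-sym; ↔-trans; Inverse⇒Injection)
open import Function.Properties.Equivalence using (⇔-setoid)
open import Relation.Binary.Bundles using (Setoid)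
open import Relation.Binary.PropositionalEquality
import Relation.Binary.Reasoning.Setoid
open import Relation.Nullary using (Dec; yes; no; ¬_; does)
open import Relation.Nullary.Decidable using (map′; ¬?; _×-dec_; _→-dec_; decidable-stable)

open Inverse using (to; from; strictlyInverseˡ; strictlyInverseʳ)
open Setoid (⇔-setoid 0ℓ) using () renaming (refl to ⇔-refl; sym to ⇔-sym; trans to ⇔-trans)
module ⇔-Reasoning = Relation.Binary.Reasoning.Setoid (⇔-setoid 0ℓ)

⇔-cong : ∀ {A A′ B B′ : Set} → A ⇔ A′ → B ⇔ B′ → (A ⇔ B) ⇔ (A′ ⇔ B′)
⇔-cong a b = mk⇔ (λ e → ⇔-trans (⇔-sym a) (⇔-trans e b)) (λ e → ⇔-trans a (⇔-trans e (⇔-sym b)))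

⇔-comm : ∀ {A B : Set} → (A ⇔ B) ⇔ (B ⇔ A)
⇔-comm = mk⇔ ⇔-sym ⇔-sym

∀-reindex : ∀ {A B : Set} {P : A → Set} {Q : B → Set} (σ : A ↔ B) →
            (∀ a → P a ⇔ Q (to σ a)) → (∀ a → P a) ⇔ (∀ b → Q b)
∀-reindex {Q = Q} σ e = mk⇔
  (λ p b → subst Q (strictlyInverseˡ σ b) (Equivalence.to (e (from σ b)) (p (from σ b))))
  (λ q a → Equivalence.from (e a) (q (to σ a)))

≢-cong : ∀ {A B : Set} (σ : A ↔ B) {x y : A} → (¬ x ≡ y) ⇔ (¬ to σ x ≡ to σ y)
≢-cong σ = mk⇔ (λ x≢y → x≢y ∘ Injection.injective (Inverse⇒Injection σ)) (λ σx≢σy → σx≢σy ∘ cong (to σ))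

isomorphic-sym : ∀ {n} {F G : OrdFact n} → Isomorphic F G → Isomorphic G F
isomorphic-sym {n} (π , forth , back) =
  ↔-sym π , mapΣ₂ mapsOnto-sym ∘ back , mapΣ₂ mapsOnto-sym ∘ forth
  where
  mapsOnto-sym : ∀ {f g : EdgeSet n} → MapsOnto π f g → MapsOnto (↔-sym π) g f
  mapsOnto-sym {f} {g} m u v =
    ⇔-sym (subst₂ (λ x y → f (from π u) (from π v) ⇔ g x y)
                  (strictlyInverseˡ π u) (strictlyInverseˡ π v) (m (from π u) (from π v)))

isomorphic-trans : ∀ {n} {F G H : OrdFact n} → Isomorphic F G → Isomorphic G H → Isomorphic F H
isomorphic-trans (π , forth , back) (ρ , forth′ , back′) =
  ↔-trans π ρ ,
  (λ i → let (j , m) = forth i ; (k , m′) = forth′ j in k , λ u v → ⇔-trans (m u v) (m′ _ _)) ,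
  (λ k → let (j , m′) = back′ k ; (i , m) = back j in i , λ u v → ⇔-trans (m u v) (m′ _ _))

𝓕-conj132 : ∀ {n} (T : Triples n) → Isomorphic (𝓕 T) (𝓕 (conj p132 T))
𝓕-conj132 T = swap-↔ , (λ i → i , swapsSides i) , (λ i → i , swapsSides i)
  where
  swapsSides : ∀ i → MapsOnto swap-↔ (rowFactor T i) (rowFactor (conj p132 T) i)
  swapsSides i (inj₁ _) (inj₁ _) = ⇔-refl
  swapsSides i (inj₁ _) (inj₂ _) = ⇔-refl
  swapsSides i (inj₂ _) (inj₁ _) = ⇔-refl
  swapsSides i (inj₂ _) (inj₂ _) = ⇔-refl

conj-isLatin : ∀ {n} {T : Triples n} X → IsLatin T → IsLatin (conj X T)
conj-isLatin p123 latin = latin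
conj-isLatin p132 (cell , row , col) = row , cell , λ c s → col s c
conj-isLatin p213 (cell , row , col) = (λ r c → cell c r) , col , row
conj-isLatin p231 (cell , row , col) = col , (λ r s → cell s r) , (λ c s → row s c)
conj-isLatin p312 (cell , row , col) = (λ r c → row c r) , (λ r s → col s r) , cell
conj-isLatin p321 (cell , row , col) = (λ r c → col c r) , (λ r s → row s r) , (λ c s → cell s c)

isotopic-sym : ∀ {n} {T T′ : Triples n} → Isotopic T T′ → Isotopic T′ T
isotopic-sym {T = T} {T′} (α , β , γ , iso) = ↔-sym α , ↔-sym β , ↔-sym γ , iso⁻¹
  where
  iso⁻¹ : ∀ a b c → T′ a b c ≡ T (from α a) (from β b) (from γ c)
  iso⁻¹ a b c rewrite iso (from α a) (from β b) (from γ c)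
                    | strictlyInverseˡ α a | strictlyInverseˡ β b | strictlyInverseˡ γ c = refl

image : ∀ {n} → Fin n ↔ Fin n → Subset n → Subset n
image σ C = tabulate (λ y → lookup C (from σ y))

module _ {n} (σ : Fin n ↔ Fin n) where

  ∈-image⇔ : ∀ {C y} → y ∈ image σ C ⇔ from σ y ∈ C
  ∈-image⇔ {C} {y} = mk⇔
    (λ y∈ → lookup⇒[]= _ C (trans (sym (lookup∘tabulate _ y)) ([]=⇒lookup y∈)))
    (λ σy∈ → lookup⇒[]= y _ (trans (lookup∘tabulate _ y) ([]=⇒lookup σy∈)))

  to-∈-image⇔ : ∀ {C x} → to σ x ∈ image σ C ⇔ x ∈ C
  to-∈-image⇔ {C} {x} = subst (λ z → to σ x ∈ image σ C ⇔ z ∈ C) (strictlyInverseʳ σ x) ∈-image⇔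

  image-image⁻¹ : ∀ D → image σ (image (↔-sym σ) D) ≡ D
  image-image⁻¹ D = trans (tabulate-cong λ y → trans (lookup∘tabulate _ (from σ y))
                                                     (cong (lookup D) (strictlyInverseˡ σ y)))
                          (tabulate∘lookup D)

  image-⊤ : image σ ⊤ ≡ ⊤
  image-⊤ = ⊆-antisym ⊆⊤ (λ _ → Equivalence.from ∈-image⇔ ∈⊤)

  nonempty-image⇔ : ∀ {C} → Nonempty C ⇔ Nonempty (image σ C)
  nonempty-image⇔ = mk⇔ (λ (x , x∈) → to σ x , Equivalence.from to-∈-image⇔ x∈)
                        (λ (y , y∈) → from σ y , Equivalence.to ∈-image⇔ y∈)

module _ {n} (σ : Fin n ↔ Fin n) where

  image⁻¹-⊂ : ∀ {C D} → D ⊂ image σ C → image (↔-sym σ) D ⊂ C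
  image⁻¹-⊂ {C} {D} (D⊆ , y , y∈ , y∉D) =
    (λ x∈ → Equivalence.to (to-∈-image⇔ σ) (D⊆ (Equivalence.to (∈-image⇔ (↔-sym σ)) x∈))) ,
    from σ y , Equivalence.to (∈-image⇔ σ) y∈ ,
    λ σy∈ → y∉D (subst (_∈ D) (strictlyInverseˡ σ y) (Equivalence.to (∈-image⇔ (↔-sym σ)) σy∈))

  image-≡⊤ : ∀ {C} → image σ C ≡ ⊤ → C ≡ ⊤
  image-≡⊤ {C} σC≡⊤ = begin
    C                            ≡⟨ image-image⁻¹ (↔-sym σ) C ⟨
    image (↔-sym σ) (image σ C)  ≡⟨ cong (image (↔-sym σ)) σC≡⊤ ⟩
    image (↔-sym σ) ⊤            ≡⟨ image-⊤ (↔-sym σ) ⟩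
    ⊤                            ∎
    where open ≡-Reasoning

RowSymbol : ∀ {n} → Triples n → Fin n → Subset n → Fin n → Set
RowSymbol T r C s = ∃ λ c → c ∈ C × Ent T r c s

rowCycle-image : ∀ {n} {T T′ : Triples n} {r r′ s s′} (σ : Fin n ↔ Fin n) →
                 (∀ C → Subrect T r r′ C ⇔ Subrect T′ s s′ (image σ C)) →
                 ∀ {C} → RowCycle T r r′ C → RowCycle T′ s s′ (image σ C)
rowCycle-image {T′ = T′} {s = s} {s′} σ rect⇔ {C} (rect , minimal) =
  Equivalence.to (rect⇔ C) rect ,
  λ D D⊂ rectD → minimal (image (↔-sym σ) D) (image⁻¹-⊂ σ D⊂)
    (Equivalence.from (rect⇔ (image (↔-sym σ) D))
      (subst (Subrect T′ s s′) (sym (image-image⁻¹ σ D)) rectD))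

rowHam-transfer : ∀ {n} {T T′ : Triples n} →
  (∀ r r′ → ∃₂ λ s s′ → Σ (Fin n ↔ Fin n) λ σ →
              ∀ C → Subrect T r r′ C ⇔ Subrect T′ s s′ (image σ C)) →
  RowHam T′ → RowHam T
rowHam-transfer {n} correspond ham r r′ C cycle with correspond r r′
... | s , s′ , σ , rect⇔ = begin
  ∣ C ∣      ≡⟨ cong ∣_∣ (image-≡⊤ σ {C} σC≡⊤) ⟩
  ∣ ⊤ {n} ∣  ≡⟨ ∣⊤∣≡n n ⟩
  n          ∎
  where
  open ≡-Reasoning
  σC≡⊤ : image σ C ≡ ⊤
  σC≡⊤ = ∣p∣≡n⇒p≡⊤ (ham s s′ (image σ C) (rowCycle-image σ rect⇔ cycle))

module Isotopy {n} {T T′ : Triples n} (isotopy : Isotopic T T′) where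
  private
    α β γ : Fin n ↔ Fin n
    α = proj₁ isotopy
    β = proj₁ (proj₂ isotopy)
    γ = proj₁ (proj₂ (proj₂ isotopy))

  ent⇔ : ∀ r c s → Ent T r c s ⇔ Ent T′ (to α r) (to β c) (to γ s)
  ent⇔ r c s = mk⇔ (trans (sym (iso r c s))) (trans (iso r c s))
    where iso = proj₂ (proj₂ (proj₂ isotopy))

  𝓕-isomorphic : Isomorphic (𝓕 T) (𝓕 T′)
  𝓕-isomorphic =
    ⊎-cong β γ , (λ i → to α i , maps i) ,
    λ i′ → from α i′ , subst (MapsOnto (⊎-cong β γ) (rowFactor T (from α i′)) ∘ rowFactor T′)
                             (strictlyInverseˡ α i′) (maps (from α i′))
    where
    maps : ∀ i → MapsOnto (⊎-cong β γ) (rowFactor T i) (rowFactor T′ (to α i))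
    maps i (inj₁ _) (inj₁ _) = ⇔-refl
    maps i (inj₁ c) (inj₂ s) = ent⇔ i c s
    maps i (inj₂ s) (inj₁ c) = ent⇔ i c s
    maps i (inj₂ _) (inj₂ _) = ⇔-refl

  rowSymbol⇔ : ∀ r C s → RowSymbol T r C s ⇔ RowSymbol T′ (to α r) (image β C) (to γ s)
  rowSymbol⇔ r C s = mk⇔
    (λ (c , c∈ , e) → to β c , Equivalence.from (to-∈-image⇔ β) c∈ , Equivalence.to (ent⇔ r c s) e)
    (λ (d , d∈ , e) → from β d , Equivalence.to (∈-image⇔ β) d∈ ,
       Equivalence.from (ent⇔ r (from β d) s)
         (subst (λ d → Ent T′ (to α r) d (to γ s)) (sym (strictlyInverseˡ β d)) e))

  subrect⇔ : ∀ r r′ C → Subrect T r r′ C ⇔ Subrect T′ (to α r) (to α r′) (image β C)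
  subrect⇔ r r′ C = ≢-cong α ×-⇔ nonempty-image⇔ β ×-⇔
    ∀-reindex γ (λ s → ⇔-cong (rowSymbol⇔ r C s) (rowSymbol⇔ r′ C s))

  rowHam-from : RowHam T′ → RowHam T
  rowHam-from = rowHam-transfer (λ r r′ → to α r , to α r′ , β , subrect⇔ r r′)

rowHam-isotopic : ∀ {n} {T T′ : Triples n} → Isotopic T T′ → RowHam T ⇔ RowHam T′
rowHam-isotopic isotopy = mk⇔ (Isotopy.rowHam-from (isotopic-sym isotopy)) (Isotopy.rowHam-from isotopy)

module Latin {n} {T : Triples n} (latin : IsLatin T) where

  symbol column : Fin n → Fin n → Fin n
  symbol r c = proj₁ (proj₁ latin r c)
  column r s = proj₁ (proj₁ (proj₂ latin) r s)

  symbol-ent : ∀ r c → Ent T r c (symbol r c)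
  symbol-ent r c = proj₁ (proj₂ (proj₁ latin r c))

  column-ent : ∀ r s → Ent T r (column r s) s
  column-ent r s = proj₁ (proj₂ (proj₁ (proj₂ latin) r s))

  symbol-unique : ∀ {r c s} → Ent T r c s → symbol r c ≡ s
  symbol-unique {r} {c} = proj₂ (proj₂ (proj₁ latin r c))

  column-unique : ∀ {r c s} → Ent T r c s → column r s ≡ c
  column-unique {r} {s = s} = proj₂ (proj₂ (proj₁ (proj₂ latin) r s))

  rowPermutation : Fin n → Fin n ↔ Fin n
  rowPermutation r = mk↔ₛ′ (symbol r) (column r)
    (λ s → symbol-unique (column-ent r s)) (λ c → column-unique (symbol-ent r c))

  rowSymbol⇔ : ∀ {r C s} → RowSymbol T r C s ⇔ column r s ∈ C
  rowSymbol⇔ {r} {C} {s} = mk⇔ (λ (c , c∈ , e) → subst (_∈ C) (sym (column-unique e)) c∈)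
                               (λ p → column r s , p , column-ent r s)

module RowInverse {n} {T : Triples n} (latin : IsLatin T) where
  open Latin latin
  private
    T′ = conj p132 T
    module L′ = Latin (conj-isLatin p132 latin)

  subrect⇔ : ∀ r r′ C → Subrect T r r′ C ⇔ Subrect T′ r r′ (image (rowPermutation r) C)
  -- A symbol s of T corresponds to the column `column r′ s` of T′, with rows r and r′ exchanging roles.
  subrect⇔ r r′ C = ⇔-refl ×-⇔ nonempty-image⇔ σ ×-⇔
    ∀-reindex (↔-sym (rowPermutation r′)) (λ s → ⇔-trans (⇔-cong (row-r s) (row-r′ s)) ⇔-comm)
    where
    σ = rowPermutation r
    D = image σ C
    open ⇔-Reasoning

    row-r : ∀ s → RowSymbol T r C s ⇔ RowSymbol T′ r′ D (column r′ s)
    row-r s = begin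
      RowSymbol T r C s                   ≈⟨ rowSymbol⇔ ⟩
      column r s ∈ C                      ≈⟨ ∈-image⇔ σ ⟨
      s ∈ D                               ≡⟨ cong (_∈ D) (strictlyInverseˡ (rowPermutation r′) s) ⟨
      symbol r′ (column r′ s) ∈ D         ≈⟨ L′.rowSymbol⇔ ⟨
      RowSymbol T′ r′ D (column r′ s)     ∎

    row-r′ : ∀ s → RowSymbol T r′ C s ⇔ RowSymbol T′ r D (column r′ s)
    row-r′ s = begin
      RowSymbol T r′ C s                  ≈⟨ rowSymbol⇔ ⟩
      column r′ s ∈ C                     ≈⟨ to-∈-image⇔ σ ⟨
      symbol r (column r′ s) ∈ D          ≈⟨ L′.rowSymbol⇔ ⟨
      RowSymbol T′ r D (column r′ s)      ∎

  rowHam-from : RowHam T′ → RowHam T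
  rowHam-from = rowHam-transfer (λ r r′ → r , r′ , rowPermutation r , subrect⇔ r r′)

rowHam-conj132 : ∀ {n} (T : Triples n) → IsLatin T → RowHam T ⇔ RowHam (conj p132 T)
rowHam-conj132 T latin =
  mk⇔ (RowInverse.rowHam-from (conj-isLatin p132 latin)) (RowInverse.rowHam-from latin)

_⇔?_ : ∀ {A B : Set} → Dec A → Dec B → Dec (A ⇔ B)
a? ⇔? b? = map′ (uncurry mk⇔) (λ e → Equivalence.to e , Equivalence.from e)
                ((a? →-dec b?) ×-dec (b? →-dec a?))

allSubsets? : ∀ {n} {P : Subset n → Set} → (∀ C → Dec (P C)) → Dec (∀ C → P C)
allSubsets? P? with anySubset? (¬? ∘ P?)
... | yes (C , ¬p) = no (λ p → ¬p (p C))
... | no ¬∃ = yes (λ C → decidable-stable (P? C) (λ ¬p → ¬∃ (C , ¬p)))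

module _ {n} (T : Triples n) where

  rowSymbol? : ∀ r C s → Dec (RowSymbol T r C s)
  rowSymbol? r C s = any? (λ c → c ∈? C ×-dec T r c s ≟ᵇ true)

  subrect? : ∀ r r′ C → Dec (Subrect T r r′ C)
  subrect? r r′ C = ¬? (r ≟ᶠ r′) ×-dec nonempty? C ×-dec
                    all? (λ s → rowSymbol? r C s ⇔? rowSymbol? r′ C s)

  rowCycle? : ∀ r r′ C → Dec (RowCycle T r r′ C)
  rowCycle? r r′ C = subrect? r r′ C ×-dec allSubsets? (λ C′ → C′ ⊂? C →-dec ¬? (subrect? r r′ C′))

  rowHam? : Dec (RowHam T)
  rowHam? = all? λ r → all? λ r′ → allSubsets? λ C → rowCycle? r r′ C →-dec ∣ C ∣ ≟ℕ n

module ConjugacyClasses {P : Perm3 → Set}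
  (123⇔132 : P p123 ⇔ P p132) (123⇔213 : P p123 ⇔ P p213)
  (213⇔231 : P p213 ⇔ P p231) (312⇔321 : P p312 ⇔ P p321) where

  open Equivalence using (to; from)

  count : (a : Dec (P p123)) (b : Dec (P p312)) →
          Count P allPerm3 ((if does a then 4 else 0) + (if does b then 2 else 0))
  count a b = class₁ a (class₂ b)
    where
    class₁ : ∀ {k} (a : Dec (P p123)) → Count P (p312 ∷ p321 ∷ []) k →
             Count P allPerm3 ((if does a then 4 else 0) + k)
    class₁ (yes a) rest = here a (here (to 123⇔132 a) (here a′ (here (to 213⇔231 a′) rest)))
      where a′ = to 123⇔213 a
    class₁ (no ¬a) rest = skip ¬a (skip (¬a ∘ from 123⇔132) (skip ¬a′ (skip (¬a′ ∘ from 213⇔231) rest)))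
      where ¬a′ = ¬a ∘ from 123⇔213
    class₂ : (b : Dec (P p312)) → Count P (p312 ∷ p321 ∷ []) (if does b then 2 else 0)
    class₂ (yes b) = here b (here (to 312⇔321 b) nil)
    class₂ (no ¬b) = skip ¬b (skip (¬b ∘ from 312⇔321) nil)

  count-4⊎6 : P p123 → Dec (P p312) → Count P allPerm3 4 ⊎ Count P allPerm3 6
  count-4⊎6 a (yes b) = inj₂ (count (yes a) (yes b))
  count-4⊎6 a (no ¬b) = inj₁ (count (yes a) (no ¬b))

  count-2⊎6 : P p321 → Dec (P p123) → Count P allPerm3 2 ⊎ Count P allPerm3 6
  count-2⊎6 b (yes a) = inj₂ (count (yes a) (yes (from 312⇔321 b)))
  count-2⊎6 b (no ¬a) = inj₁ (count (no ¬a) (yes (from 312⇔321 b)))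

lemma3 : (n : ℕ) (L : Triples n) → IsLatin L → Isotopic L (transpose L) →
           (Isomorphic (𝓕[ p123 ] L) (𝓕[ p132 ] L) ×
            Isomorphic (𝓕[ p123 ] L) (𝓕[ p213 ] L) ×
            Isomorphic (𝓕[ p123 ] L) (𝓕[ p231 ] L) ×
            Isomorphic (𝓕[ p132 ] L) (𝓕[ p213 ] L) ×
            Isomorphic (𝓕[ p132 ] L) (𝓕[ p231 ] L) ×
            Isomorphic (𝓕[ p213 ] L) (𝓕[ p231 ] L)) ×
           (RowHam L → NuIs L 4 ⊎ NuIs L 6) ×
           (RowHam (conj p321 L) → NuIs L 2 ⊎ NuIs L 6)
lemma3 n L latin isotopy =
  (≅132 , ≅213 , ≅231 , through123 p132 p213 ≅132 ≅213 ,
   through123 p132 p231 ≅132 ≅231 , through123 p213 p231 ≅213 ≅231) ,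
  (λ ham → count-4⊎6 ham (rowHam? (conj p312 L))) ,
  (λ ham → count-2⊎6 ham (rowHam? L))
  where
  ≅132 : Isomorphic (𝓕[ p123 ] L) (𝓕[ p132 ] L)
  ≅132 = 𝓕-conj132 L
  ≅213 : Isomorphic (𝓕[ p123 ] L) (𝓕[ p213 ] L)
  ≅213 = Isotopy.𝓕-isomorphic isotopy
  -- Isomorphic is not injective in its arguments, so these have to be given explicitly.
  ≅231 : Isomorphic (𝓕[ p123 ] L) (𝓕[ p231 ] L)
  ≅231 = isomorphic-trans {F = 𝓕[ p123 ] L} {𝓕[ p213 ] L} {𝓕[ p231 ] L} ≅213 (𝓕-conj132 (transpose L))

  through123 : ∀ X Y → Isomorphic (𝓕[ p123 ] L) (𝓕[ X ] L) → Isomorphic (𝓕[ p123 ] L) (𝓕[ Y ] L) →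
               Isomorphic (𝓕[ X ] L) (𝓕[ Y ] L)
  through123 X Y ≅X ≅Y = isomorphic-trans {F = 𝓕[ X ] L} {𝓕[ p123 ] L} {𝓕[ Y ] L}
                            (isomorphic-sym {F = 𝓕[ p123 ] L} {𝓕[ X ] L} ≅X) ≅Y

  open ConjugacyClasses {λ X → RowHam (conj X L)}
    (rowHam-conj132 L latin) (rowHam-isotopic isotopy)
    (rowHam-conj132 (transpose L) (conj-isLatin p213 latin))
    (rowHam-conj132 (conj p312 L) (conj-isLatin p312 latin))
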